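{- Let $d\ge1$, $n\ge1$, and $0\le k\le d$. Every $d$-dimensional latin hypercube $Q$ of order $n$ contains at most $\binom{d}{k}n^{2d-1}(n-1)^k$ cuboctahedra of dimension $k$, and at most $n^{3d-1}$ cuboctahedra in total.
   Context: A $d$-dimensional latin hypercube of order $n$ is an array $Q=(q_\alpha)$ indexed by $\alpha\in\{0,\ldots,n-1\}^d$ with entries in $\{0,\ldots,n-1\}$ such that any two indices differing in exactly one coordinate carry different symbols (each line contains all $n$ symbols). A cuboctahedron in $Q$ is a tuple consisting of $d$ ordered pairs $(a^i_1,a^i_2)$ and $d$ ordered pairs $(b^i_1,b^i_2)$, $i=1,\ldots,d$, with all $a^i_j,b^i_j\in\{0,\ldots,n-1\}$, such that $q_{a^1_{j_1},\ldots,a^d_{j_d}}=q_{b^1_{j_1},\ldots,b^d_{j_d}}$ for all $j_1,\ldots,j_d\in\{1,2\}$; cuboctahedra are counted as such tuples. A cuboctahedron has dimension $k$ if there are exactly $k$ indices $i$ with $a^i_1\neq a^i_2$ (equivalently, with $b^i_1\ne b^i_2$). -}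

module Defs where

open import Data.Nat using (ℕ; zero; suc)
open import Data.Bool using (Bool; true; false; if_then_else_)
open import Data.Fin using (Fin)
open import Data.Fin.Properties using () renaming (_≟_ to _≟ᶠ_)
open import Data.Product using (_×_; _,_; proj₁; proj₂; ∃-syntax)
open import Data.Vec as V using (Vec; []; _∷_; lookup)
open import Data.List as L using (List; length; filter; cartesianProduct)
open import Relation.Binary.PropositionalEquality using (_≡_; _≢_)
open import Relation.Nullary using (Dec; yes; no; ¬?)
open import Relation.Nullary.Decidable using (_×-dec_)
open import Relation.Unary using (Decidable)

Index : ℕ → ℕ → Set
Index d n = Vec (Fin n) d

Array : ℕ → ℕ → Set
Array d n = Index d n → Fin n

DifferInExactlyOne : ∀ {d n} → Index d n → Index d n → Set
DifferInExactlyOne {d} α β =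
  ∃[ i ] (lookup α i ≢ lookup β i × (∀ j → j ≢ i → lookup α j ≡ lookup β j))

IsLatinHypercube : ∀ {d n} → Array d n → Set
IsLatinHypercube {d} {n} Q =
  ∀ (α β : Index d n) → DifferInExactlyOne α β → Q α ≢ Q β

pick : ∀ {n} → Fin n × Fin n → Bool → Fin n
pick (x , y) false = x
pick (x , y) true  = y

select : ∀ {d n} → Vec (Fin n × Fin n) d → Vec Bool d → Index d n
select a j = V.zipWith pick a j

IsCuboctahedron : ∀ {d n} → Array d n →
  Vec (Fin n × Fin n) d × Vec (Fin n × Fin n) d → Set
IsCuboctahedron {d} Q (a , b) = ∀ (j : Vec Bool d) → Q (select a j) ≡ Q (select b j)

∀vec? : ∀ d {P : Vec Bool d → Set} → (∀ j → Dec (P j)) → Dec (∀ j → P j)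
∀vec? zero P? with P? []
... | yes p = yes λ { [] → p }
... | no ¬p = no λ h → ¬p (h [])
∀vec? (suc d) {P} P? with ∀vec? d (λ j → P? (false ∷ j)) | ∀vec? d (λ j → P? (true ∷ j))
... | yes p | yes q = yes λ { (false ∷ j) → p j ; (true ∷ j) → q j }
... | no ¬p | _ = no λ h → ¬p (λ j → h (false ∷ j))
... | yes _ | no ¬q = no λ h → ¬q (λ j → h (true ∷ j))

isCuboctahedron? : ∀ {d n} (Q : Array d n) → Decidable (IsCuboctahedron Q)
isCuboctahedron? {d} Q (a , b) = ∀vec? d (λ j → Q (select a j) ≟ᶠ Q (select b j))

allVecs : ∀ {A : Set} → List A → (d : ℕ) → List (Vec A d)
allVecs xs zero = L.[ [] ]
allVecs xs (suc d) = L.concatMap (λ x → L.map (x ∷_) (allVecs xs d)) xs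

-- all tuples ((a^i_1,a^i_2))_i , ((b^i_1,b^i_2))_i
allTuples : ∀ d n → List (Vec (Fin n × Fin n) d × Vec (Fin n × Fin n) d)
allTuples d n = cartesianProduct (allVecs pairs d) (allVecs pairs d)
  where pairs = cartesianProduct (L.allFin n) (L.allFin n)

dimension : ∀ {d n} → Vec (Fin n × Fin n) d → ℕ
dimension a = V.count (λ p → ¬? (proj₁ p ≟ᶠ proj₂ p)) a

HasDimension : ∀ {d n} → ℕ → Vec (Fin n × Fin n) d × Vec (Fin n × Fin n) d → Set
HasDimension k (a , b) = dimension a ≡ k

numCuboctahedra : ∀ {d n} → Array d n → ℕ
numCuboctahedra {d} {n} Q = length (filter (isCuboctahedron? Q) (allTuples d n))

numCuboctahedraOfDim : ∀ {d n} → Array d n → ℕ → ℕ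
numCuboctahedraOfDim {d} {n} Q k =
  length (filter (λ t → isCuboctahedron? Q t ×-dec (dimension (proj₁ t) Data.Nat.≟ k))
                 (allTuples d n))

-- Fix the first half a of a cuboctahedron.  By the latin property the second half b is then
-- determined by b²₁, …, bᵈ₁ alone, so a is completed in at most n^(d-1) ways.  Summing over the
-- (n²)^d choices of a gives n^(3d-1); restricting to the C(d,k) nᵈ (n-1)ᵏ choices of a of
-- dimension k gives the first bound.
module Submission where

open import Defs
open import Level using (Level)
open import Data.Nat using (ℕ; zero; suc; _+_; _*_; _∸_; _^_; _≤_; z≤n; s≤s; _≟_)
open import Data.Nat.Properties
open import Data.Nat.Combinatorics using (_C_; nCk+nC[k+1]≡[n+1]C[k+1])
open import Data.Nat.Solver using (module +-*-Solver)
open import Data.Nat.ListAction using (sum)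
open import Data.Product using (_×_; _,_; proj₁; proj₂)
open import Data.Bool using (Bool; false)
open import Data.Fin using (Fin; zero; suc)
open import Data.Fin.Properties using () renaming (_≟_ to _≟ᶠ_)
open import Data.Vec as V using (Vec; []; _∷_; lookup)
open import Data.Vec.Properties using (∷-injective; lookup-zipWith; lookup-replicate; lookup∘tabulate; tabulate∘lookup; tabulate-cong; lookup-map)
open import Data.List using (List; []; _∷_; length; filter; map; _++_; concatMap; cartesianProduct; cartesianProductWith; allFin)
open import Data.List.Properties using (length-++; length-map; length-tabulate; filter-++; filter-≐; filter-none; filter-some; length-removeAt′)
open import Data.List.Relation.Unary.All as All using ([])
open import Data.List.Relation.Unary.AllPairs using ([]; _∷_)
open import Data.List.Relation.Unary.Any as Any using (here; there; index)
open import Data.List.Relation.Unary.Unique.Propositional using (Unique)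
open import Data.List.Relation.Unary.Unique.Propositional.Properties using (cartesianProductWith⁺; cartesianProduct⁺; allFin⁺; filter⁺)
open import Data.List.Membership.Propositional using (_∈_; _─_)
open import Data.List.Membership.Propositional.Properties using (∈-cartesianProductWith⁺; ∈-allFin; ∈-filter⁻)
open import Function using (_∘_)
open import Relation.Binary.PropositionalEquality
open import Relation.Nullary using (yes; no; does; ¬_; ¬?; contradiction)
open import Relation.Nullary.Decidable using (dec-true; dec-false; decidable-stable; _×-dec_)
open import Relation.Unary using (Pred; Decidable; _≐_)
open import Algebra.Properties.CommutativeSemigroup +-commutativeSemigroup using (x∙yz≈y∙xz)

private
  variable
    p q : Level
    A B D : Set

count : {P : Pred A p} → Decidable P → List A → ℕ
count P? xs = length (filter P? xs)

module _ {P : Pred A p} (P? : Decidable P) where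

  count-++ : ∀ xs ys → count P? (xs ++ ys) ≡ count P? xs + count P? ys
  count-++ xs ys = trans (cong length (filter-++ P? xs ys)) (length-++ (filter P? xs))

  count-map : ∀ (f : B → A) xs → count P? (map f xs) ≡ count (P? ∘ f) xs
  count-map f [] = refl
  count-map f (x ∷ xs) with P? (f x)
  ... | yes _ = cong suc (count-map f xs)
  ... | no _  = count-map f xs

  count-cartesianProductWith : ∀ (f : B → D → A) xs ys →
    count P? (cartesianProductWith f xs ys) ≡ sum (map (λ x → count (P? ∘ f x) ys) xs)
  count-cartesianProductWith f []       ys = refl
  count-cartesianProductWith f (x ∷ xs) ys =
    trans (count-++ (map (f x) ys) _)
          (cong₂ _+_ (count-map (f x) ys) (count-cartesianProductWith f xs ys))

  count+count-¬≡length : ∀ xs → count P? xs + count (¬? ∘ P?) xs ≡ length xs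
  count+count-¬≡length []       = refl
  count+count-¬≡length (x ∷ xs) with P? x
  ... | yes _ = cong suc (count+count-¬≡length xs)
  ... | no _  = trans (+-suc _ _) (cong suc (count+count-¬≡length xs))

  sum-map-≤-split : ∀ (f : A → ℕ) u v xs → (∀ x → P x → f x ≤ u) → (∀ x → ¬ P x → f x ≤ v) →
    sum (map f xs) ≤ count P? xs * u + count (¬? ∘ P?) xs * v
  sum-map-≤-split f u v []       _  _  = z≤n
  sum-map-≤-split f u v (x ∷ xs) fu fv with P? x
  ... | yes px = subst (f x + sum (map f xs) ≤_) (sym (+-assoc u (count P? xs * u) (count (¬? ∘ P?) xs * v)))
                   (+-mono-≤ (fu x px) (sum-map-≤-split f u v xs fu fv))
  ... | no ¬px = subst (f x + sum (map f xs) ≤_) (x∙yz≈y∙xz v (count P? xs * u) (count (¬? ∘ P?) xs * v))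
                   (+-mono-≤ (fv x ¬px) (sum-map-≤-split f u v xs fu fv))

module _ {P : Pred A p} {Q : Pred A q} (P? : Decidable P) (Q? : Decidable Q) where

  count-≐ : P ≐ Q → ∀ xs → count P? xs ≡ count Q? xs
  count-≐ P≐Q xs = cong length (filter-≐ P? Q? P≐Q xs)

count-none : {P : Pred A p} (P? : Decidable P) → (∀ x → ¬ P x) → ∀ xs → count P? xs ≡ 0
count-none P? ¬P xs = cong length (filter-none P? {xs} (All.tabulate (λ {x} _ → ¬P x)))

sum-map-≤ : ∀ (f : A → ℕ) c xs → (∀ x → f x ≤ c) → sum (map f xs) ≤ length xs * c
sum-map-≤ f c []       _ = z≤n
sum-map-≤ f c (x ∷ xs) h = +-mono-≤ (h x) (sum-map-≤ f c xs h)

module _ {R : Pred (A × B) p} (R? : Decidable R) {c : ℕ} (xs : List A) (ys : List B)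
         (row-bound : ∀ x → count (λ y → R? (x , y)) ys ≤ c) where

  count-cartesianProduct-≤ : count R? (cartesianProduct xs ys) ≤ length xs * c
  count-cartesianProduct-≤ = begin
    count R? (cartesianProduct xs ys)                         ≡⟨ count-cartesianProductWith R? _,_ xs ys ⟩
    sum (map (λ x → count (λ y → R? (x , y)) ys) xs)          ≤⟨ sum-map-≤ _ c xs row-bound ⟩
    length xs * c                                             ∎
    where open ≤-Reasoning

  count-cartesianProduct-selectedRows-≤ : {P : Pred A q} (P? : Decidable P) →
    count (λ t → R? t ×-dec P? (proj₁ t)) (cartesianProduct xs ys) ≤ count P? xs * c
  count-cartesianProduct-selectedRows-≤ {P = P} P? = begin
    count (λ t → R? t ×-dec P? (proj₁ t)) (cartesianProduct xs ys)
      ≡⟨ count-cartesianProductWith (λ t → R? t ×-dec P? (proj₁ t)) _,_ xs ys ⟩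
    sum (map f xs)                                 ≤⟨ sum-map-≤-split P? f c 0 xs selected unselected ⟩
    count P? xs * c + count (¬? ∘ P?) xs * 0       ≡⟨ cong (count P? xs * c +_) (*-zeroʳ (count (¬? ∘ P?) xs)) ⟩
    count P? xs * c + 0                            ≡⟨ +-identityʳ (count P? xs * c) ⟩
    count P? xs * c                                ∎
    where
    open ≤-Reasoning
    f : A → ℕ
    f x = count (λ y → R? (x , y) ×-dec P? x) ys
    selected : ∀ x → P x → f x ≤ c
    selected x px = ≤-trans (≤-reflexive (count-≐ _ _ (proj₁ , (_, px)) ys)) (row-bound x)
    unselected : ∀ x → ¬ P x → f x ≤ 0
    unselected x ¬px = ≤-reflexive (count-none _ (λ _ → ¬px ∘ proj₂) ys)

∈-─ : ∀ {x y : A} {cs} (x∈cs : x ∈ cs) → y ∈ cs → y ≢ x → y ∈ cs ─ x∈cs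
∈-─ (here refl)  (here refl)  y≢x = contradiction refl y≢x
∈-─ (here refl)  (there y∈cs) _   = y∈cs
∈-─ (there x∈cs) (here refl)  _   = here refl
∈-─ (there x∈cs) (there y∈cs) y≢x = there (∈-─ x∈cs y∈cs y≢x)

length-≤-injection : ∀ (g : A → B) {us cs} → Unique us →
  (∀ {u v} → u ∈ us → v ∈ us → g u ≡ g v → u ≡ v) → (∀ {u} → u ∈ us → g u ∈ cs) →
  length us ≤ length cs
length-≤-injection g {[]}     _               _   _  = z≤n
length-≤-injection g {u ∷ us} {cs} (u∉us ∷ uniq) inj maps =
  subst (suc (length us) ≤_) (sym (length-removeAt′ cs (index (maps (here refl)))))
    (s≤s (length-≤-injection g uniq (λ u∈ v∈ → inj (there u∈) (there v∈)) maps′))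
  where
  maps′ : ∀ {v} → v ∈ us → g v ∈ cs ─ maps (here refl)
  maps′ v∈us = ∈-─ (maps (here refl)) (maps (there v∈us))
    (λ gv≡gu → All.lookup u∉us v∈us (sym (inj (there v∈us) (here refl) gv≡gu)))

concatMap-map≡cartesianProductWith : ∀ (f : A → B → D) xs ys →
  concatMap (λ x → map (f x) ys) xs ≡ cartesianProductWith f xs ys
concatMap-map≡cartesianProductWith f []       ys = refl
concatMap-map≡cartesianProductWith f (x ∷ xs) ys =
  cong (map (f x) ys ++_) (concatMap-map≡cartesianProductWith f xs ys)

length-cartesianProductWith : ∀ (f : A → B → D) xs ys →
  length (cartesianProductWith f xs ys) ≡ length xs * length ys
length-cartesianProductWith f []       ys = refl
length-cartesianProductWith f (x ∷ xs) ys =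
  trans (length-++ (map (f x) ys))
        (cong₂ _+_ (length-map (f x) ys) (length-cartesianProductWith f xs ys))

allVecs-suc : ∀ (xs : List A) d → allVecs xs (suc d) ≡ cartesianProductWith _∷_ xs (allVecs xs d)
allVecs-suc xs d = concatMap-map≡cartesianProductWith _∷_ xs (allVecs xs d)

length-allVecs : ∀ (xs : List A) d → length (allVecs xs d) ≡ length xs ^ d
length-allVecs xs zero    = refl
length-allVecs xs (suc d) = begin
  length (allVecs xs (suc d))                          ≡⟨ cong length (allVecs-suc xs d) ⟩
  length (cartesianProductWith _∷_ xs (allVecs xs d))  ≡⟨ length-cartesianProductWith _∷_ xs _ ⟩
  length xs * length (allVecs xs d)                    ≡⟨ cong (length xs *_) (length-allVecs xs d) ⟩
  length xs ^ suc d                                    ∎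
  where open ≡-Reasoning

∈-allVecs : ∀ {xs : List A} → (∀ x → x ∈ xs) → ∀ {d} (v : Vec A d) → v ∈ allVecs xs d
∈-allVecs complete []      = here refl
∈-allVecs {xs = xs} complete {suc d} (x ∷ v) =
  subst ((x ∷ v) ∈_) (sym (allVecs-suc xs d))
    (∈-cartesianProductWith⁺ _∷_ (complete x) (∈-allVecs complete v))

allVecs⁺ : ∀ {xs : List A} → Unique xs → ∀ d → Unique (allVecs xs d)
allVecs⁺ uniq zero = [] ∷ []
allVecs⁺ {xs = xs} uniq (suc d) =
  subst Unique (sym (allVecs-suc xs d))
    (cartesianProductWith⁺ _∷_ ∷-injective uniq (allVecs⁺ uniq d))

count-allVecs-suc : ∀ {d} {P : Pred (Vec A (suc d)) p} (P? : Decidable P) xs →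
  count P? (allVecs xs (suc d)) ≡ sum (map (λ x → count (P? ∘ (x ∷_)) (allVecs xs d)) xs)
count-allVecs-suc {d = d} P? xs =
  trans (cong (count P?) (allVecs-suc xs d)) (count-cartesianProductWith P? _∷_ xs (allVecs xs d))

module _ {P : Pred A p} (P? : Decidable P) {x : A} where

  count-∷-accept : P x → ∀ {d} (v : Vec A d) → V.count P? (x ∷ v) ≡ suc (V.count P? v)
  count-∷-accept px v with P? x
  ... | yes _  = refl
  ... | no ¬px = contradiction px ¬px

  count-∷-reject : ¬ P x → ∀ {d} (v : Vec A d) → V.count P? (x ∷ v) ≡ V.count P? v
  count-∷-reject ¬px v with P? x
  ... | yes px = contradiction px ¬px
  ... | no _   = refl

-- Induction on d via Pascal's rule.  Bounding the two classes by r w and r, rather than by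
-- their sizes, keeps the truncated exponent d ∸ k out of the recurrence.
module _ {P : Pred A p} (P? : Decidable P) (xs : List A) {r w : ℕ}
         (¬P-bound : count (¬? ∘ P?) xs ≤ r) (P-bound : count P? xs ≤ r * w) where

  private
    N : ℕ → ℕ → ℕ
    N d k = count (λ v → V.count P? v ≟ k) (allVecs xs d)

    reject-≐ : ∀ {x d} → ¬ P x → ∀ k → (λ (v : Vec A d) → V.count P? (x ∷ v) ≡ k) ≐ (λ v → V.count P? v ≡ k)
    reject-≐ ¬px k = (λ {v} → trans (sym (count-∷-reject P? ¬px v))) , (λ {v} → trans (count-∷-reject P? ¬px v))

    accept-≐ : ∀ {x d} → P x → ∀ k → (λ (v : Vec A d) → V.count P? (x ∷ v) ≡ suc k) ≐ (λ v → V.count P? v ≡ k)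
    accept-≐ px k = (λ {v} e → suc-injective (trans (sym (count-∷-accept P? px v)) e))
                  , (λ {v} e → trans (count-∷-accept P? px v) (cong suc e))

  count-allVecs-count≡-≤ : ∀ d k → count (λ v → V.count P? v ≟ k) (allVecs xs d) ≤ (d C k) * r ^ d * w ^ k
  count-allVecs-count≡-≤ zero    zero    = ≤-refl
  count-allVecs-count≡-≤ zero    (suc k) = z≤n
  count-allVecs-count≡-≤ (suc d) zero    = begin
    N (suc d) 0                                       ≡⟨ count-allVecs-suc _ xs ⟩
    sum (map f xs)                                    ≤⟨ sum-map-≤-split P? f 0 (N d 0) xs accept reject ⟩
    count P? xs * 0 + count (¬? ∘ P?) xs * N d 0      ≡⟨ cong (_+ count (¬? ∘ P?) xs * N d 0) (*-zeroʳ (count P? xs)) ⟩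
    count (¬? ∘ P?) xs * N d 0                        ≤⟨ *-mono-≤ ¬P-bound (count-allVecs-count≡-≤ d 0) ⟩
    r * (1 * r ^ d * 1)                               ≡⟨ solve 2 (λ r R → r :* (con 1 :* R :* con 1) := con 1 :* (r :* R) :* con 1) refl r (r ^ d) ⟩
    1 * r ^ suc d * 1                                 ∎
    where
    open ≤-Reasoning
    open +-*-Solver
    f : A → ℕ
    f x = count (λ v → V.count P? (x ∷ v) ≟ 0) (allVecs xs d)
    accept : ∀ x → P x → f x ≤ 0
    accept x px = ≤-reflexive (count-none _ (λ v e → 0≢1+n (trans (sym e) (count-∷-accept P? px v))) (allVecs xs d))
    reject : ∀ x → ¬ P x → f x ≤ N d 0
    reject x ¬px = ≤-reflexive (count-≐ _ _ (reject-≐ ¬px 0) (allVecs xs d))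
  count-allVecs-count≡-≤ (suc d) (suc k) = begin
    N (suc d) (suc k)                                 ≡⟨ count-allVecs-suc _ xs ⟩
    sum (map f xs)                                    ≤⟨ sum-map-≤-split P? f (N d k) (N d (suc k)) xs accept reject ⟩
    count P? xs * N d k + count (¬? ∘ P?) xs * N d (suc k)
      ≤⟨ +-mono-≤ (*-mono-≤ P-bound (count-allVecs-count≡-≤ d k)) (*-mono-≤ ¬P-bound (count-allVecs-count≡-≤ d (suc k))) ⟩
    r * w * ((d C k) * r ^ d * w ^ k) + r * ((d C suc k) * r ^ d * w ^ suc k)
      ≡⟨ solve 6 (λ r w A B R W → r :* w :* (A :* R :* W) :+ r :* (B :* R :* (w :* W)) := (A :+ B) :* (r :* R) :* (w :* W))
               refl r w (d C k) (d C suc k) (r ^ d) (w ^ k) ⟩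
    (d C k + d C suc k) * r ^ suc d * w ^ suc k       ≡⟨ cong (λ c → c * r ^ suc d * w ^ suc k) (nCk+nC[k+1]≡[n+1]C[k+1] d k) ⟩
    (suc d C suc k) * r ^ suc d * w ^ suc k           ∎
    where
    open ≤-Reasoning
    open +-*-Solver
    f : A → ℕ
    f x = count (λ v → V.count P? (x ∷ v) ≟ suc k) (allVecs xs d)
    accept : ∀ x → P x → f x ≤ N d k
    accept x px = ≤-reflexive (count-≐ _ _ (accept-≐ px k) (allVecs xs d))
    reject : ∀ x → ¬ P x → f x ≤ N d (suc k)
    reject x ¬px = ≤-reflexive (count-≐ _ _ (reject-≐ ¬px (suc k)) (allVecs xs d))

module _ {d n} {Q : Array d n} (latin : IsLatinHypercube Q) where

  latin-agree : ∀ {α β : Index d n} i → Q α ≡ Q β →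
    (∀ j → j ≢ i → lookup α j ≡ lookup β j) → lookup α i ≡ lookup β i
  latin-agree {α} {β} i Qα≡Qβ agree with lookup α i ≟ᶠ lookup β i
  ... | yes αi≡βi = αi≡βi
  ... | no  αi≢βi = contradiction Qα≡Qβ (latin α β (i , αi≢βi , agree))

  module _ {a b b′ : Vec (Fin n × Fin n) d}
           (cub : IsCuboctahedron Q (a , b)) (cub′ : IsCuboctahedron Q (a , b′)) where

    private
      lookup-select : ∀ (c : Vec (Fin n × Fin n) d) {j t s} → lookup j t ≡ s →
        lookup (select c j) t ≡ pick (lookup c t) s
      lookup-select c {j} {t} j[t]≡s = trans (lookup-zipWith pick t c j) (cong (pick (lookup c t)) j[t]≡s)

      select-agree : ∀ j t → (∀ s → s ≢ t → lookup (select b j) s ≡ lookup (select b′ j) s) →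
        lookup (select b j) t ≡ lookup (select b′ j) t
      select-agree j t = latin-agree t (trans (sym (cub j)) (cub′ j))

    seconds-agree : (∀ t → proj₁ (lookup b t) ≡ proj₁ (lookup b′ t)) →
      ∀ t → proj₂ (lookup b t) ≡ proj₂ (lookup b′ t)
    seconds-agree firsts t = begin
      proj₂ (lookup b t)           ≡⟨ lookup-select b (at t (dec-true (t ≟ᶠ t) refl)) ⟨
      lookup (select b (e t)) t    ≡⟨ select-agree (e t) t off-t ⟩
      lookup (select b′ (e t)) t   ≡⟨ lookup-select b′ (at t (dec-true (t ≟ᶠ t) refl)) ⟩
      proj₂ (lookup b′ t)          ∎
      where
      open ≡-Reasoning
      e : Fin d → Vec Bool d
      e t = V.tabulate (λ s → does (s ≟ᶠ t))
      at : ∀ s {c} → does (s ≟ᶠ t) ≡ c → lookup (e t) s ≡ c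
      at s eq = trans (lookup∘tabulate _ s) eq
      off-t : ∀ s → s ≢ t → lookup (select b (e t)) s ≡ lookup (select b′ (e t)) s
      off-t s s≢t = trans (lookup-select b (at s (dec-false (s ≟ᶠ t) s≢t)))
                   (trans (firsts s) (sym (lookup-select b′ (at s (dec-false (s ≟ᶠ t) s≢t)))))

    first-agrees : ∀ t → (∀ s → s ≢ t → proj₁ (lookup b s) ≡ proj₁ (lookup b′ s)) →
      proj₁ (lookup b t) ≡ proj₁ (lookup b′ t)
    first-agrees t firsts = begin
      proj₁ (lookup b t)                 ≡⟨ lookup-select b (lookup-replicate t false) ⟨
      lookup (select b allFirst) t       ≡⟨ select-agree allFirst t off-t ⟩
      lookup (select b′ allFirst) t      ≡⟨ lookup-select b′ (lookup-replicate t false) ⟩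
      proj₁ (lookup b′ t)                ∎
      where
      open ≡-Reasoning
      allFirst : Vec Bool d
      allFirst = V.replicate d false
      off-t : ∀ s → s ≢ t → lookup (select b allFirst) s ≡ lookup (select b′ allFirst) s
      off-t s s≢t = trans (lookup-select b (lookup-replicate s false))
                   (trans (firsts s s≢t) (sym (lookup-select b′ (lookup-replicate s false))))

tailFirsts : ∀ {m n} → Vec (Fin n × Fin n) (suc m) → Vec (Fin n) m
tailFirsts b = V.map proj₁ (V.tail b)

-- b¹₁ is forced by the vertex selecting all first components, then each bⁱ₂ by the
-- vertex selecting the second component in direction i only.
cuboctahedron-determined : ∀ {m n} {Q : Array (suc m) n} → IsLatinHypercube Q →
  ∀ {a b b′} → IsCuboctahedron Q (a , b) → IsCuboctahedron Q (a , b′) →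
  tailFirsts b ≡ tailFirsts b′ → b ≡ b′
cuboctahedron-determined latin {b = b@(_ ∷ bs)} {b′@(_ ∷ bs′)} cub cub′ tails≡ = begin
  b                                   ≡⟨ tabulate∘lookup b ⟨
  V.tabulate (lookup b)               ≡⟨ tabulate-cong (λ t → cong₂ _,_ (firsts t) (seconds-agree latin cub cub′ firsts t)) ⟩
  V.tabulate (lookup b′)              ≡⟨ tabulate∘lookup b′ ⟩
  b′                                  ∎
  where
  open ≡-Reasoning
  tail-firsts : ∀ s → proj₁ (lookup bs s) ≡ proj₁ (lookup bs′ s)
  tail-firsts s = trans (sym (lookup-map s proj₁ bs))
                 (trans (cong (λ v → lookup v s) tails≡) (lookup-map s proj₁ bs′))
  firsts : ∀ t → proj₁ (lookup b t) ≡ proj₁ (lookup b′ t)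
  firsts zero    = first-agrees latin cub cub′ zero λ { zero 0≢0 → contradiction refl 0≢0 ; (suc s) _ → tail-firsts s }
  firsts (suc s) = tail-firsts s

pairs : ∀ n → List (Fin n × Fin n)
pairs n = cartesianProduct (allFin n) (allFin n)

length-allFin : ∀ n → length (allFin n) ≡ n
length-allFin n = length-tabulate {n = n} (λ i → i)

length-pairs : ∀ n → length (pairs n) ≡ n * n
length-pairs n = trans (length-cartesianProductWith _,_ (allFin n) (allFin n))
                       (cong₂ _*_ (length-allFin n) (length-allFin n))

count-cuboctahedra-with-first-half-≤ : ∀ {m n} {Q : Array (suc m) n} → IsLatinHypercube Q → ∀ a →
  count (λ b → isCuboctahedron? Q (a , b)) (allVecs (pairs n) (suc m)) ≤ n ^ m
count-cuboctahedra-with-first-half-≤ {m} {n} {Q} latin a = begin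
  count cub? (allVecs (pairs n) (suc m))   ≤⟨ length-≤-injection tailFirsts unique injective maps ⟩
  length (allVecs (allFin n) m)            ≡⟨ length-allVecs (allFin n) m ⟩
  length (allFin n) ^ m                    ≡⟨ cong (_^ m) (length-allFin n) ⟩
  n ^ m                                    ∎
  where
  open ≤-Reasoning
  cub? : Decidable (λ b → IsCuboctahedron Q (a , b))
  cub? b = isCuboctahedron? Q (a , b)
  halves = allVecs (pairs n) (suc m)
  unique : Unique (filter cub? halves)
  unique = filter⁺ cub? (allVecs⁺ (cartesianProduct⁺ (allFin⁺ n) (allFin⁺ n)) (suc m))
  injective : ∀ {u v} → u ∈ filter cub? halves → v ∈ filter cub? halves → tailFirsts u ≡ tailFirsts v → u ≡ v
  injective u∈ v∈ = cuboctahedron-determined latin (proj₂ (∈-filter⁻ cub? {xs = halves} u∈)) (proj₂ (∈-filter⁻ cub? {xs = halves} v∈))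
  maps : ∀ {u} → u ∈ filter cub? halves → tailFirsts u ∈ allVecs (allFin n) m
  maps {u} _ = ∈-allVecs ∈-allFin (tailFirsts u)

offDiagonal? : ∀ {n} → Decidable (λ (p : Fin n × Fin n) → proj₁ p ≢ proj₂ p)
offDiagonal? p = ¬? (proj₁ p ≟ᶠ proj₂ p)

module _ {n} (x : Fin n) where

  count-row-diagonal : count (λ y → ¬? (¬? (x ≟ᶠ y))) (allFin n) ≤ 1
  count-row-diagonal = length-≤-injection (λ y → y) {cs = x ∷ []} (filter⁺ diag? (allFin⁺ n)) (λ _ _ eq → eq)
    (λ {y} y∈ → here (sym (decidable-stable (x ≟ᶠ y) (proj₂ (∈-filter⁻ diag? {xs = allFin n} y∈)))))
    where
    diag? = λ y → ¬? (¬? (x ≟ᶠ y))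

  count-row-offDiagonal : count (λ y → ¬? (x ≟ᶠ y)) (allFin n) ≤ n ∸ 1
  count-row-offDiagonal = begin
    c                  ≡⟨ m+n∸n≡m c c¬ ⟨
    c + c¬ ∸ c¬        ≤⟨ ∸-monoʳ-≤ (c + c¬) (filter-some (¬? ∘ off?) (Any.map (λ x≡y x≢y → x≢y x≡y) (∈-allFin x))) ⟩
    c + c¬ ∸ 1         ≡⟨ cong (_∸ 1) (trans (count+count-¬≡length off? (allFin n)) (length-allFin n)) ⟩
    n ∸ 1              ∎
    where
    open ≤-Reasoning
    off? = λ y → ¬? (x ≟ᶠ y)
    c  = count off? (allFin n)
    c¬ = count (¬? ∘ off?) (allFin n)

count-diagonal : ∀ n → count (¬? ∘ offDiagonal?) (pairs n) ≤ n
count-diagonal n = begin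
  count (¬? ∘ offDiagonal?) (pairs n)  ≡⟨ count-cartesianProductWith (¬? ∘ offDiagonal?) _,_ (allFin n) (allFin n) ⟩
  sum (map _ (allFin n))               ≤⟨ sum-map-≤ _ 1 (allFin n) count-row-diagonal ⟩
  length (allFin n) * 1                ≡⟨ trans (*-identityʳ _) (length-allFin n) ⟩
  n                                    ∎
  where open ≤-Reasoning

count-offDiagonal : ∀ n → count offDiagonal? (pairs n) ≤ n * (n ∸ 1)
count-offDiagonal n = begin
  count offDiagonal? (pairs n)         ≡⟨ count-cartesianProductWith offDiagonal? _,_ (allFin n) (allFin n) ⟩
  sum (map _ (allFin n))               ≤⟨ sum-map-≤ _ (n ∸ 1) (allFin n) count-row-offDiagonal ⟩
  length (allFin n) * (n ∸ 1)          ≡⟨ cong (_* (n ∸ 1)) (length-allFin n) ⟩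
  n * (n ∸ 1)                          ∎
  where open ≤-Reasoning

count-dimension : ∀ n d k → count (λ a → dimension a ≟ k) (allVecs (pairs n) d) ≤ (d C k) * n ^ d * (n ∸ 1) ^ k
count-dimension n = count-allVecs-count≡-≤ offDiagonal? (pairs n) (count-diagonal n) (count-offDiagonal n)

^-distrib-* : ∀ a b k → (a * b) ^ k ≡ a ^ k * b ^ k
^-distrib-* a b zero    = refl
^-distrib-* a b (suc k) = begin
  a * b * (a * b) ^ k          ≡⟨ cong (a * b *_) (^-distrib-* a b k) ⟩
  a * b * (a ^ k * b ^ k)      ≡⟨ solve 4 (λ a b A B → a :* b :* (A :* B) := a :* A :* (b :* B)) refl a b (a ^ k) (b ^ k) ⟩
  a * a ^ k * (b * b ^ k)      ∎
  where
  open ≡-Reasoning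
  open +-*-Solver

^-2*[1+m]∸1 : ∀ n m → n ^ (2 * suc m ∸ 1) ≡ n ^ suc m * n ^ m
^-2*[1+m]∸1 n m = begin
  n ^ (m + (suc m + 0))    ≡⟨ cong (λ e → n ^ (m + e)) (+-identityʳ (suc m)) ⟩
  n ^ (m + suc m)          ≡⟨ ^-distribˡ-+-* n m (suc m) ⟩
  n ^ m * n ^ suc m        ≡⟨ *-comm (n ^ m) _ ⟩
  n ^ suc m * n ^ m        ∎
  where open ≡-Reasoning

^-3*[1+m]∸1 : ∀ n m → n ^ (3 * suc m ∸ 1) ≡ (n * n) ^ suc m * n ^ m
^-3*[1+m]∸1 n m = begin
  n ^ (m + (suc m + (suc m + 0)))   ≡⟨ cong (λ e → n ^ (m + (suc m + e))) (+-identityʳ (suc m)) ⟩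
  n ^ (m + (suc m + suc m))         ≡⟨ ^-distribˡ-+-* n m (suc m + suc m) ⟩
  n ^ m * n ^ (suc m + suc m)       ≡⟨ cong (n ^ m *_) (^-distribˡ-+-* n (suc m) (suc m)) ⟩
  n ^ m * (n ^ suc m * n ^ suc m)   ≡⟨ cong (n ^ m *_) (^-distrib-* n n (suc m)) ⟨
  n ^ m * (n * n) ^ suc m           ≡⟨ *-comm (n ^ m) _ ⟩
  (n * n) ^ suc m * n ^ m           ∎
  where open ≡-Reasoning

proposition2 : ∀ (d n : ℕ) → 1 ≤ d → 1 ≤ n → (Q : Array d n) → IsLatinHypercube Q →
    (∀ (k : ℕ) → k ≤ d →
      numCuboctahedraOfDim Q k ≤ (d C k) * n ^ (2 * d ∸ 1) * (n ∸ 1) ^ k)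
    × numCuboctahedra Q ≤ n ^ (3 * d ∸ 1)
proposition2 (suc m) n _ _ Q latin = dimension-bound , total-bound
  where
  open ≤-Reasoning
  halves = allVecs (pairs n) (suc m)
  per-half = count-cuboctahedra-with-first-half-≤ latin

  dimension-bound : ∀ k → k ≤ suc m → numCuboctahedraOfDim Q k ≤ (suc m C k) * n ^ (2 * suc m ∸ 1) * (n ∸ 1) ^ k
  dimension-bound k _ = begin
    numCuboctahedraOfDim Q k
      ≤⟨ count-cartesianProduct-selectedRows-≤ (isCuboctahedron? Q) halves halves per-half (λ a → dimension a ≟ k) ⟩
    count (λ a → dimension a ≟ k) halves * n ^ m
      ≤⟨ *-monoˡ-≤ (n ^ m) (count-dimension n (suc m) k) ⟩
    (suc m C k) * n ^ suc m * (n ∸ 1) ^ k * n ^ m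
      ≡⟨ solve 4 (λ c N w M → c :* N :* w :* M := c :* (N :* M) :* w) refl (suc m C k) (n ^ suc m) ((n ∸ 1) ^ k) (n ^ m) ⟩
    (suc m C k) * (n ^ suc m * n ^ m) * (n ∸ 1) ^ k
      ≡⟨ cong (λ e → (suc m C k) * e * (n ∸ 1) ^ k) (^-2*[1+m]∸1 n m) ⟨
    (suc m C k) * n ^ (2 * suc m ∸ 1) * (n ∸ 1) ^ k ∎
    where open +-*-Solver

  total-bound : numCuboctahedra Q ≤ n ^ (3 * suc m ∸ 1)
  total-bound = begin
    numCuboctahedra Q             ≤⟨ count-cartesianProduct-≤ (isCuboctahedron? Q) halves halves per-half ⟩
    length halves * n ^ m         ≡⟨ cong (_* n ^ m) (trans (length-allVecs (pairs n) (suc m)) (cong (_^ suc m) (length-pairs n))) ⟩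
    (n * n) ^ suc m * n ^ m       ≡⟨ ^-3*[1+m]∸1 n m ⟨
    n ^ (3 * suc m ∸ 1)           ∎
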